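{- Let $X$ be a set with $3\le|X|\le\aleph_0$ and let $\varphi$ be a coloring on $X$ that is not reconstructible. Then $r(\varphi)\ne 2$.
   Context: A coloring on $X$ is a function $\varphi:[X]^2\to\{0,1\}$, $[X]^2$ being the $2$-element subsets of $X$. $\mathrm{hom}(\varphi)=\{H\subseteq X:\ |H|>2 \text{ and } \varphi \text{ is constant on } [H]^2\}$. $\varphi$ is reconstructible if for every coloring $\psi$ on $X$ with $\mathrm{hom}(\psi)=\mathrm{hom}(\varphi)$ one has $\psi=\varphi$ or $\psi=1-\varphi$. For non-reconstructible $\varphi$, $r(\varphi)$ is the minimum, over all colorings $\psi$ on $X$ with $\mathrm{hom}(\psi)=\mathrm{hom}(\varphi)$, $\psi\ne\varphi$, $\psi\ne1-\varphi$, of the cardinality $|\{\{x,y\}\in[X]^2:\varphi(\{x,y\})\ne\psi(\{x,y\})\}|$. -}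

module Defs where

open import Data.Nat using (ℕ)
open import Data.Bool using (Bool; not)
open import Data.Product using (Σ; ∃; _×_; _,_)
open import Data.Sum using (_⊎_)
open import Data.Empty using (⊥)
open import Relation.Nullary using (¬_)
open import Relation.Binary.PropositionalEquality using (_≡_; _≢_)
open import Function.Definitions using (Injective)
open import Level using (0ℓ)

Countable : Set → Set
Countable X = Σ (X → ℕ) λ f → Injective _≡_ _≡_ f

AtLeast3 : (X : Set) → (X → Set) → Set
AtLeast3 X H = Σ X λ a → Σ X λ b → Σ X λ c →
  H a × H b × H c × a ≢ b × a ≢ c × b ≢ c

-- A coloring φ : [X]² → {0,1}, represented as a symmetric function
-- X → X → Bool whose diagonal values are irrelevant (only used on x ≢ y).
record Coloring (X : Set) : Set where
  field
    col : X → X → Bool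
    sym : ∀ x y → col x y ≡ col y x
open Coloring public

compl : {X : Set} → Coloring X → Coloring X
compl φ = record { col = λ x y → not (col φ x y)
                 ; sym = λ x y → cong′ (sym φ x y) }
  where
  cong′ : ∀ {a b : Bool} → a ≡ b → not a ≡ not b
  cong′ Relation.Binary.PropositionalEquality.refl = Relation.Binary.PropositionalEquality.refl

_≈c_ : {X : Set} → Coloring X → Coloring X → Set
_≈c_ {X} φ ψ = ∀ (x y : X) → x ≢ y → col φ x y ≡ col ψ x y

InHom : {X : Set} → Coloring X → (X → Set) → Set
InHom {X} φ H = AtLeast3 X H ×
  Σ Bool λ c → ∀ (x y : X) → H x → H y → x ≢ y → col φ x y ≡ c

SameHom : {X : Set} → Coloring X → Coloring X → Set₁
SameHom {X} φ ψ = ∀ (H : X → Set) → (InHom φ H → InHom ψ H) × (InHom ψ H → InHom φ H)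

Reconstructible : {X : Set} → Coloring X → Set₁
Reconstructible {X} φ = ∀ (ψ : Coloring X) → SameHom φ ψ → (ψ ≈c φ) ⊎ (ψ ≈c compl φ)

Competitor : {X : Set} → Coloring X → Coloring X → Set₁
Competitor φ ψ = SameHom φ ψ × ¬ (ψ ≈c φ) × ¬ (ψ ≈c compl φ)

SamePair : {X : Set} → X → X → X → X → Set
SamePair x y u v = (x ≡ u × y ≡ v) ⊎ (x ≡ v × y ≡ u)

Diff : {X : Set} → Coloring X → Coloring X → X → X → Set
Diff φ ψ x y = x ≢ y × col φ x y ≢ col ψ x y

DiffExactly2 : {X : Set} → Coloring X → Coloring X → Set
DiffExactly2 {X} φ ψ = Σ X λ a → Σ X λ b → Σ X λ c → Σ X λ d →
  Diff φ ψ a b × Diff φ ψ c d × ¬ SamePair a b c d ×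
  (∀ x y → Diff φ ψ x y → SamePair x y a b ⊎ SamePair x y c d)

DiffAtMost1 : {X : Set} → Coloring X → Coloring X → Set
DiffAtMost1 {X} φ ψ = ∀ x y u v → Diff φ ψ x y → Diff φ ψ u v → SamePair x y u v

-- r(φ) = 2 : some competitor differs on exactly 2 pairs, and no competitor
-- differs on at most 1 pair (so the minimum is exactly 2).
RIsTwo : {X : Set} → Coloring X → Set₁
RIsTwo {X} φ = (Σ (Coloring X) λ ψ → Competitor φ ψ × DiffExactly2 φ ψ) ×
               (∀ (ψ : Coloring X) → Competitor φ ψ → ¬ DiffAtMost1 φ ψ)

-- Suppose ψ has the same homogeneous sets as φ and differs from it exactly on two pairs.
-- A triangle is homogeneous for φ iff it is for ψ, so recolouring a single edge {a,b} of
-- a triangle {a,b,z} forces φ(a,z) ≠ φ(b,z). A pair {s,t} with φ(s,z) ≠ φ(t,z) for all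
-- other z lies in no homogeneous set, so recolouring it alone gives a competitor at
-- distance 1; as r(φ) = 2, each difference pair {a,b} has a z with φ(a,z) = φ(b,z). Then
-- the other difference pair is an edge of {a,b,z}: the pairs are {e,p} and {e,z} with
-- φ(e,p) ≠ φ(e,z) = φ(p,z), while the same argument started from {e,z} gives
-- φ(e,z) ≠ φ(e,p) = φ(z,p), which is contradictory.
module Submission where

open import Defs
open import Relation.Nullary using (¬_)
open import Data.Unit using (⊤)

open import Data.Bool using (Bool; not)
open import Data.Bool.Properties using (¬-not; not-¬) renaming (_≟_ to _≟ᵇ_)
open import Data.Nat.Properties using () renaming (_≟_ to _≟ℕ_)
open import Data.Product using (Σ; _×_; _,_; proj₁; proj₂)
open import Data.Sum using (_⊎_; inj₁; inj₂; [_,_]; swap)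
open import Data.Empty using (⊥; ⊥-elim)
open import Function using (_∘_; id; _⇔_; mk⇔; Equivalence)
open import Function.Bundles using (mk↣)
open import Function.Properties.Equivalence using () renaming (trans to ⇔-trans; sym to ⇔-sym)
open import Relation.Nullary using (Dec; yes; no)
open import Relation.Nullary.Decidable using (_×-dec_; _⊎-dec_; via-injection)
open import Relation.Binary.Definitions using (DecidableEquality)
open import Relation.Binary.PropositionalEquality
  using (_≡_; _≢_; refl; cong; trans; ≢-sym) renaming (sym to ≡-sym)

countable⇒decEq : {X : Set} → Countable X → DecidableEquality X
countable⇒decEq (f , f-injective) = via-injection (mk↣ f-injective) _≟ℕ_

Monochromatic : Bool → Bool → Bool → Set
Monochromatic u v w = u ≡ v × u ≡ w

monochromatic-flip₁ : {u v w : Bool} →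
  Monochromatic u v w ⇔ Monochromatic (not u) v w → v ≢ w
monochromatic-flip₁ {u} {v} iff refl with u ≟ᵇ v
... | yes refl = not-¬ refl (≡-sym (proj₁ (Equivalence.to iff (refl , refl))))
... | no u≢v   = u≢v (proj₁ (Equivalence.from iff (v≡¬u , v≡¬u)))
  where v≡¬u = ≡-sym (¬-not (≢-sym u≢v))

monochromatic-flip₂ : {u v w : Bool} →
  Monochromatic u v w ⇔ Monochromatic (not u) (not v) w → u ≢ v
monochromatic-flip₂ {u} {_} {w} iff refl with u ≟ᵇ w
... | yes refl = not-¬ refl (≡-sym (proj₂ (Equivalence.to iff (refl , refl))))
... | no u≢w   = u≢w (proj₂ (Equivalence.from iff (refl , ≡-sym (¬-not (≢-sym u≢w)))))

module _ {X : Set} where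

  private
    variable
      a b c d e f p q s t u v w x y z : X
      φ ψ χ₁ χ₂ : Coloring X

  outsidePoint : DecidableEquality X → {H : X → Set} → AtLeast3 X H → (s t : X) →
                Σ X λ z → H z × z ≢ s × z ≢ t
  outsidePoint _≟_ (x , y , z , hx , hy , hz , x≢y , x≢z , y≢z) s t
    with x ≟ s | x ≟ t | y ≟ s | y ≟ t
  ... | no x≢s | no x≢t | _        | _        = x , hx , x≢s , x≢t
  ... | yes refl | _    | _        | no y≢t   = y , hy , ≢-sym x≢y , y≢t
  ... | yes refl | _    | _        | yes refl = z , hz , ≢-sym x≢z , ≢-sym y≢z
  ... | no x≢s | yes refl | no y≢s | _        = y , hy , y≢s , ≢-sym x≢y
  ... | no x≢s | yes refl | yes refl | _      = z , hz , ≢-sym y≢z , ≢-sym x≢z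

  samePair? : DecidableEquality X → (x y u v : X) → Dec (SamePair x y u v)
  samePair? _≟_ x y u v = (x ≟ u ×-dec y ≟ v) ⊎-dec (x ≟ v ×-dec y ≟ u)

  samePair-swap : SamePair x y u v → SamePair y x u v
  samePair-swap (inj₁ (refl , refl)) = inj₂ (refl , refl)
  samePair-swap (inj₂ (refl , refl)) = inj₁ (refl , refl)

  samePair-sym : SamePair x y u v → SamePair u v x y
  samePair-sym (inj₁ (refl , refl)) = inj₁ (refl , refl)
  samePair-sym (inj₂ (refl , refl)) = inj₂ (refl , refl)

  samePair-trans : SamePair x y u v → SamePair u v s t → SamePair x y s t
  samePair-trans (inj₁ (refl , refl)) q = q
  samePair-trans (inj₂ (refl , refl)) q = samePair-swap q

  samePair⇒first∈ : SamePair x y u v → x ≡ u ⊎ x ≡ v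
  samePair⇒first∈ (inj₁ (x≡u , _)) = inj₁ x≡u
  samePair⇒first∈ (inj₂ (x≡v , _)) = inj₂ x≡v

  samePair⇒second∈ : SamePair x y u v → y ≡ u ⊎ y ≡ v
  samePair⇒second∈ = samePair⇒first∈ ∘ samePair-swap

  samePair-cancelˡ : u ≢ v → SamePair x y u v → SamePair x w u v → w ≡ y
  samePair-cancelˡ _   (inj₁ (refl , refl)) (inj₁ (refl , refl)) = refl
  samePair-cancelˡ u≢v (inj₁ (refl , refl)) (inj₂ (refl , refl)) = ⊥-elim (u≢v refl)
  samePair-cancelˡ u≢v (inj₂ (refl , refl)) (inj₁ (refl , refl)) = ⊥-elim (u≢v refl)
  samePair-cancelˡ _   (inj₂ (refl , refl)) (inj₂ (refl , refl)) = refl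

  Triangle : X → X → X → X → Set
  Triangle x y z w = w ≡ x ⊎ w ≡ y ⊎ w ≡ z

  inHom-triangle⇔monochromatic : (χ : Coloring X) → x ≢ y → x ≢ z → y ≢ z →
    InHom χ (Triangle x y z) ⇔ Monochromatic (col χ x y) (col χ x z) (col χ y z)
  inHom-triangle⇔monochromatic {x = x} {y = y} {z = z} χ x≢y x≢z y≢z = mk⇔ to from
    where
    to : InHom χ (Triangle x y z) → Monochromatic (col χ x y) (col χ x z) (col χ y z)
    to (_ , _ , constant) =
      trans xy (≡-sym xz) , trans xy (≡-sym yz)
      where
      xy = constant x y (inj₁ refl) (inj₂ (inj₁ refl)) x≢y
      xz = constant x z (inj₁ refl) (inj₂ (inj₂ refl)) x≢z
      yz = constant y z (inj₂ (inj₁ refl)) (inj₂ (inj₂ refl)) y≢z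

    from : Monochromatic (col χ x y) (col χ x z) (col χ y z) → InHom χ (Triangle x y z)
    from (xy≡xz , xy≡yz) =
      (x , y , z , inj₁ refl , inj₂ (inj₁ refl) , inj₂ (inj₂ refl) , x≢y , x≢z , y≢z) ,
      col χ x y , constant
      where
      constant : ∀ u v → Triangle x y z u → Triangle x y z v → u ≢ v → col χ u v ≡ col χ x y
      constant _ _ (inj₁ refl)          (inj₁ refl)          u≢v = ⊥-elim (u≢v refl)
      constant _ _ (inj₁ refl)          (inj₂ (inj₁ refl))   _   = refl
      constant _ _ (inj₁ refl)          (inj₂ (inj₂ refl))   _   = ≡-sym xy≡xz
      constant _ _ (inj₂ (inj₁ refl))   (inj₁ refl)          _   = sym χ y x
      constant _ _ (inj₂ (inj₁ refl))   (inj₂ (inj₁ refl))   u≢v = ⊥-elim (u≢v refl)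
      constant _ _ (inj₂ (inj₁ refl))   (inj₂ (inj₂ refl))   _   = ≡-sym xy≡yz
      constant _ _ (inj₂ (inj₂ refl))   (inj₁ refl)          _   = trans (sym χ z x) (≡-sym xy≡xz)
      constant _ _ (inj₂ (inj₂ refl))   (inj₂ (inj₁ refl))   _   = trans (sym χ z y) (≡-sym xy≡yz)
      constant _ _ (inj₂ (inj₂ refl))   (inj₂ (inj₂ refl))   u≢v = ⊥-elim (u≢v refl)

  sameHom⇒monochromatic⇔ : SameHom φ ψ → x ≢ y → x ≢ z → y ≢ z →
    Monochromatic (col φ x y) (col φ x z) (col φ y z) ⇔
    Monochromatic (col ψ x y) (col ψ x z) (col ψ y z)
  sameHom⇒monochromatic⇔ {φ = φ} {ψ = ψ} {x = x} {y = y} {z = z} same x≢y x≢z y≢z =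
    ⇔-trans (⇔-sym (inHom-triangle⇔monochromatic φ x≢y x≢z y≢z))
      (⇔-trans (mk⇔ (proj₁ (same (Triangle x y z))) (proj₂ (same (Triangle x y z))))
        (inHom-triangle⇔monochromatic ψ x≢y x≢z y≢z))

  sameHom-flip₁ : SameHom φ ψ → x ≢ y → x ≢ z → y ≢ z →
    col φ x y ≢ col ψ x y → col φ x z ≡ col ψ x z → col φ y z ≡ col ψ y z →
    col φ x z ≢ col φ y z
  sameHom-flip₁ {φ = φ} {ψ = ψ} same x≢y x≢z y≢z xy≢ xz≡ yz≡
    with sameHom⇒monochromatic⇔ {φ = φ} {ψ = ψ} same x≢y x≢z y≢z
  ... | iff rewrite ¬-not (≢-sym xy≢) | ≡-sym xz≡ | ≡-sym yz≡ = monochromatic-flip₁ iff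

  sameHom-flip₂ : SameHom φ ψ → x ≢ y → x ≢ z → y ≢ z →
    col φ x y ≢ col ψ x y → col φ x z ≢ col ψ x z → col φ y z ≡ col ψ y z →
    col φ x y ≢ col φ x z
  sameHom-flip₂ {φ = φ} {ψ = ψ} same x≢y x≢z y≢z xy≢ xz≢ yz≡
    with sameHom⇒monochromatic⇔ {φ = φ} {ψ = ψ} same x≢y x≢z y≢z
  ... | iff rewrite ¬-not (≢-sym xy≢) | ¬-not (≢-sym xz≢) | ≡-sym yz≡ = monochromatic-flip₂ iff

  record Separating (φ : Coloring X) (s t : X) : Set where
    constructor mkSeparating
    field separates : ∀ z → z ≢ s → z ≢ t → col φ s z ≢ col φ t z

  record AgreeOff (χ₁ χ₂ : Coloring X) (s t : X) : Set where
    constructor mkAgreeOff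
    field agree : ∀ x y → ¬ SamePair x y s t → col χ₁ x y ≡ col χ₂ x y

  ¬samePair-outside : z ≢ s → z ≢ t → ¬ SamePair x z s t
  ¬samePair-outside z≢s z≢t = [ z≢s , z≢t ] ∘ samePair⇒second∈

  agreeOff-sym : AgreeOff χ₁ χ₂ s t → AgreeOff χ₂ χ₁ s t
  agreeOff-sym (mkAgreeOff agree) = mkAgreeOff λ x y ¬st → ≡-sym (agree x y ¬st)

  agreeOff-separating : AgreeOff χ₁ χ₂ s t → Separating χ₁ s t → Separating χ₂ s t
  agreeOff-separating {s = s} {t = t} (mkAgreeOff agree) (mkSeparating separates) =
    mkSeparating λ z z≢s z≢t sz≡tz →
      separates z z≢s z≢t
        (trans (agree s z (¬samePair-outside z≢s z≢t))
          (trans sz≡tz (≡-sym (agree t z (¬samePair-outside z≢s z≢t)))))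

  separating⇒¬inHom : DecidableEquality X → Separating χ₁ s t →
    ∀ H → InHom χ₁ H → H s → H t → ⊥
  separating⇒¬inHom {s = s} {t = t} _≟_ (mkSeparating separates) H
    (atLeast3 , _ , constant) hs ht with outsidePoint _≟_ atLeast3 s t
  ... | z , hz , z≢s , z≢t =
    separates z z≢s z≢t
      (trans (constant s z hs hz (≢-sym z≢s)) (≡-sym (constant t z ht hz (≢-sym z≢t))))

  separating⇒inHom-transfer : DecidableEquality X → Separating χ₁ s t → AgreeOff χ₁ χ₂ s t →
    ∀ H → InHom χ₁ H → InHom χ₂ H
  separating⇒inHom-transfer {s = s} {t = t} {χ₂ = χ₂} _≟_ separating (mkAgreeOff agree) H
    inHom@(atLeast3 , c , constant) = atLeast3 , c , constant₂
    where
    constant₂ : ∀ x y → H x → H y → x ≢ y → col χ₂ x y ≡ c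
    constant₂ x y hx hy x≢y with samePair? _≟_ x y s t
    ... | no ¬st = trans (≡-sym (agree x y ¬st)) (constant x y hx hy x≢y)
    ... | yes (inj₁ (refl , refl)) = ⊥-elim (separating⇒¬inHom _≟_ separating H inHom hx hy)
    ... | yes (inj₂ (refl , refl)) = ⊥-elim (separating⇒¬inHom _≟_ separating H inHom hy hx)

  module FlipPair (_≟_ : DecidableEquality X) (φ : Coloring X) (s t : X) where

    colour : X → X → Bool
    colour x y with samePair? _≟_ x y s t
    ... | yes _ = not (col φ x y)
    ... | no _  = col φ x y

    colour-sym : ∀ x y → colour x y ≡ colour y x
    colour-sym x y with samePair? _≟_ x y s t | samePair? _≟_ y x s t
    ... | yes _  | yes _  = cong not (sym φ x y)
    ... | no _   | no _   = sym φ x y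
    ... | yes st | no ¬st = ⊥-elim (¬st (samePair-swap st))
    ... | no ¬st | yes st = ⊥-elim (¬st (samePair-swap st))

    flipped : Coloring X
    flipped = record { col = colour ; sym = colour-sym }

    flipped-agreeOff : AgreeOff φ flipped s t
    flipped-agreeOff = mkAgreeOff agree
      where
      agree : ∀ x y → ¬ SamePair x y s t → col φ x y ≡ colour x y
      agree x y ¬st with samePair? _≟_ x y s t
      ... | yes st = ⊥-elim (¬st st)
      ... | no _   = refl

    flipped-on : col flipped s t ≡ not (col φ s t)
    flipped-on with samePair? _≟_ s t s t
    ... | yes _  = refl
    ... | no ¬st = ⊥-elim (¬st (inj₁ (refl , refl)))

    differ⇒samePair : col φ x y ≢ col flipped x y → SamePair x y s t
    differ⇒samePair {x = x} {y = y} differ with samePair? _≟_ x y s t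
    ... | yes st = st
    ... | no _   = ⊥-elim (differ refl)

    flipped-diffAtMost1 : DiffAtMost1 φ flipped
    flipped-diffAtMost1 _ _ _ _ (_ , xy) (_ , uv) =
      samePair-trans (differ⇒samePair xy) (samePair-sym (differ⇒samePair uv))

    flipped-competitor : AtLeast3 X (λ _ → ⊤) → s ≢ t → Separating φ s t →
                         Competitor φ flipped
    flipped-competitor atLeast3 s≢t separating = sameHom , flipped≉φ , flipped≉compl
      where
      sameHom : SameHom φ flipped
      sameHom H =
        separating⇒inHom-transfer _≟_ separating flipped-agreeOff H ,
        separating⇒inHom-transfer _≟_ (agreeOff-separating flipped-agreeOff separating)
          (agreeOff-sym flipped-agreeOff) H

      flipped≉φ : ¬ (flipped ≈c φ)
      flipped≉φ same = not-¬ refl (trans (≡-sym (same s t s≢t)) flipped-on)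

      flipped≉compl : ¬ (flipped ≈c compl φ)
      flipped≉compl same with outsidePoint _≟_ atLeast3 s t
      ... | z , _ , z≢s , z≢t =
        not-¬ refl (trans (AgreeOff.agree flipped-agreeOff s z (¬samePair-outside z≢s z≢t))
                          (same s z (≢-sym z≢s)))

  separating⇒competitor-diffAtMost1 : DecidableEquality X → AtLeast3 X (λ _ → ⊤) →
    s ≢ t → Separating φ s t → Σ (Coloring X) λ ψ → Competitor φ ψ × DiffAtMost1 φ ψ
  separating⇒competitor-diffAtMost1 {s = s} {t = t} {φ = φ} _≟_ atLeast3 s≢t separating =
    flipped , flipped-competitor atLeast3 s≢t separating , flipped-diffAtMost1
    where open FlipPair _≟_ φ s t

  DiffersOnlyOn : Coloring X → Coloring X → X → X → X → X → Set
  DiffersOnlyOn φ ψ a b c d = ∀ x y → Diff φ ψ x y → SamePair x y a b ⊎ SamePair x y c d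

  wedge : (φ ψ : Coloring X) → SameHom φ ψ → Diff φ ψ a b → DiffersOnlyOn φ ψ a b c d →
    z ≢ a → z ≢ b → col φ a z ≡ col φ b z →
    Σ X λ e → Σ X λ p → SamePair e p a b × SamePair e z c d ×
      col φ e p ≢ col φ e z × col φ e z ≡ col φ p z
  wedge {a = a} {b = b} {c = c} {d = d} {z = z} φ ψ same (a≢b , ab≢) only z≢a z≢b az≡bz =
    cases (col φ a z ≟ᵇ col ψ a z) (col φ b z ≟ᵇ col ψ b z)
    where
    a≢z = ≢-sym z≢a
    b≢z = ≢-sym z≢b

    onSecondPair : Diff φ ψ x z → SamePair x z c d
    onSecondPair differ = [ ⊥-elim ∘ ¬samePair-outside z≢a z≢b , id ] (only _ _ differ)

    ba≢ : col φ b a ≢ col ψ b a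
    ba≢ ba≡ = ab≢ (trans (sym φ a b) (trans ba≡ (sym ψ b a)))

    cases : Dec (col φ a z ≡ col ψ a z) → Dec (col φ b z ≡ col ψ b z) →
      Σ X λ e → Σ X λ p → SamePair e p a b × SamePair e z c d ×
        col φ e p ≢ col φ e z × col φ e z ≡ col φ p z
    cases (yes az≡) (yes bz≡) =
      ⊥-elim (sameHom-flip₁ {φ = φ} {ψ = ψ} same a≢b a≢z b≢z ab≢ az≡ bz≡ az≡bz)
    cases (no az≢)  (yes bz≡) =
      a , b , inj₁ (refl , refl) , onSecondPair (a≢z , az≢) ,
      sameHom-flip₂ {φ = φ} {ψ = ψ} same a≢b a≢z b≢z ab≢ az≢ bz≡ , az≡bz
    cases (yes az≡) (no bz≢)  =
      b , a , inj₂ (refl , refl) , onSecondPair (b≢z , bz≢) ,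
      sameHom-flip₂ {φ = φ} {ψ = ψ} same (≢-sym a≢b) b≢z a≢z ba≢ bz≢ az≡ , ≡-sym az≡bz
    cases (no az≢)  (no bz≢)  =
      ⊥-elim ([ a≢b , a≢z ] (samePair⇒first∈
        (samePair-trans (onSecondPair (a≢z , az≢)) (samePair-sym (onSecondPair (b≢z , bz≢))))))

  sharedApex : a ≢ b → z ≢ a → z ≢ b →
    SamePair e p a b → SamePair e z c d → SamePair f q c d → SamePair f w a b →
    f ≡ e × q ≡ z × w ≡ p
  sharedApex a≢b z≢a z≢b ep~ab ez~cd fq~cd fw~ab with samePair-trans fq~cd (samePair-sym ez~cd)
  ... | inj₁ (refl , refl) = refl , refl , samePair-cancelˡ a≢b ep~ab fw~ab
  ... | inj₂ (refl , refl) = ⊥-elim ([ z≢a , z≢b ] (samePair⇒first∈ fw~ab))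

  wedges-clash : (φ ψ : Coloring X) → SameHom φ ψ → Diff φ ψ a b → Diff φ ψ c d →
    DiffersOnlyOn φ ψ a b c d →
    z ≢ a → z ≢ b → col φ a z ≡ col φ b z →
    w ≢ c → w ≢ d → col φ c w ≡ col φ d w → ⊥
  wedges-clash {w = w} φ ψ same ab-diff cd-diff only z≢a z≢b az≡bz w≢c w≢d cw≡dw
    with wedge φ ψ same ab-diff only z≢a z≢b az≡bz
       | wedge φ ψ same cd-diff (λ x y → swap ∘ only x y) w≢c w≢d cw≡dw
  ... | e , p , ep~ab , ez~cd , ep≢ez , ez≡pz | f , q , fq~cd , fw~ab , _ , fw≡qw
    with sharedApex (proj₁ ab-diff) z≢a z≢b ep~ab ez~cd fq~cd fw~ab
  ... | refl , refl , refl = ep≢ez (trans fw≡qw (trans (sym φ q w) (≡-sym ez≡pz)))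

mainTheorem13 : (X : Set) → Countable X → AtLeast3 X (λ _ → ⊤) →
    (φ : Coloring X) → ¬ Reconstructible φ → ¬ RIsTwo φ
mainTheorem13 X countable atLeast3 φ _
  ((ψ , (same , _) , (a , b , c , d , ab-diff , cd-diff , _ , only)) , minimal) =
  unseparated (proj₁ ab-diff) (mkSeparating λ z z≢a z≢b az≡bz →
  unseparated (proj₁ cd-diff) (mkSeparating λ w w≢c w≢d cw≡dw →
  wedges-clash φ ψ same ab-diff cd-diff only z≢a z≢b az≡bz w≢c w≢d cw≡dw))
  where
  unseparated : {s t : X} → s ≢ t → ¬ Separating φ s t
  unseparated s≢t separating
    with separating⇒competitor-diffAtMost1 (countable⇒decEq countable) atLeast3 s≢t separating
  ... | χ , competitor , atMost1 = minimal χ competitor atMost1
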